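{- Let $B$ be a complete Boolean algebra that is not weakly distributive. Then there exists $a\ne\mathbf 0$ in $B$ such that $c\in\mathrm{cl}(U)$ for every $c\le a$ and every $\tau_s$-neighborhood $U$ of $\mathbf 0$. Hence $(B,\tau_s)$ is not Hausdorff.
   Context: For a sequence $\langle b_n\rangle$ in $B$, let $\overline{\lim}\, b_n=\bigwedge_k\bigvee_{n\ge k}b_n$ and $\underline{\lim}\, b_n=\bigvee_k\bigwedge_{n\ge k}b_n$; the sequence algebraically converges to $b$ if both equal $b$. The sequential topology $\tau_s$ on $B$ is the largest topology on $B$ in which every algebraically convergent sequence converges to its algebraic limit; $\mathrm{cl}$ is closure in $\tau_s$. $B$ is weakly distributive if for every sequence $\{P_n\}$ of countable maximal antichains there is a dense set $Q$ (every nonzero $b$ has a nonzero $q\in Q$ with $q\le b$) such that each $q\in Q$ has nonzero meet with only finitely many elements of each $P_n$. -}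

module Defs where

open import Level using (Level; suc; _⊔_) renaming (zero to lzero)
open import Data.Nat using (ℕ) renaming (_≤_ to _≤ℕ_)
open import Data.Product using (Σ; Σ-syntax; _×_; _,_)
open import Data.List using (List)
open import Data.List.Membership.Propositional using (_∈_)
open import Relation.Binary.PropositionalEquality using (_≡_; _≢_)
open import Relation.Nullary using (¬_)
open import Level using (Lift)
open import Data.Unit using (⊤)
open import Data.Empty using (⊥)

-- A complete Boolean algebra, given as a bounded complemented distributive
-- lattice (order + binary meets/joins) together with arbitrary suprema of
-- subsets (subsets are predicates on the carrier).
record CBA (ℓ : Level) : Set (suc ℓ) where
  infix  4 _≤_
  infixr 7 _∧_
  infixr 6 _∨_
  field
    Carrier   : Set ℓ
    _≤_       : Carrier → Carrier → Set ℓ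
    ≤-refl    : ∀ {x} → x ≤ x
    ≤-trans   : ∀ {x y z} → x ≤ y → y ≤ z → x ≤ z
    ≤-antisym : ∀ {x y} → x ≤ y → y ≤ x → x ≡ y
    𝟎 𝟏       : Carrier
    𝟎-least   : ∀ {x} → 𝟎 ≤ x
    𝟏-greatest : ∀ {x} → x ≤ 𝟏
    _∧_ _∨_   : Carrier → Carrier → Carrier
    ∧-lb₁     : ∀ {x y} → x ∧ y ≤ x
    ∧-lb₂     : ∀ {x y} → x ∧ y ≤ y
    ∧-glb     : ∀ {x y z} → z ≤ x → z ≤ y → z ≤ x ∧ y
    ∨-ub₁     : ∀ {x y} → x ≤ x ∨ y
    ∨-ub₂     : ∀ {x y} → y ≤ x ∨ y
    ∨-lub     : ∀ {x y z} → x ≤ z → y ≤ z → x ∨ y ≤ z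
    ∧-distrib-∨ : ∀ x y z → x ∧ (y ∨ z) ≡ (x ∧ y) ∨ (x ∧ z)
    _ᶜ        : Carrier → Carrier
    ∧-compl   : ∀ x → x ∧ (x ᶜ) ≡ 𝟎
    ∨-compl   : ∀ x → x ∨ (x ᶜ) ≡ 𝟏
    ⋁         : (Carrier → Set ℓ) → Carrier
    ⋁-ub      : ∀ (S : Carrier → Set ℓ) {x} → S x → x ≤ ⋁ S
    ⋁-least   : ∀ (S : Carrier → Set ℓ) {z} → (∀ x → S x → x ≤ z) → ⋁ S ≤ z

  ⋀ : (Carrier → Set ℓ) → Carrier
  ⋀ S = ⋁ (λ x → ∀ s → S s → x ≤ s)

module _ {ℓ : Level} (B : CBA ℓ) where
  open CBA B

  Subset : Set (suc ℓ)
  Subset = Carrier → Set ℓ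

  _⊆_ : Subset → Subset → Set ℓ
  U ⊆ V = ∀ x → U x → V x

  supFrom : (ℕ → Carrier) → ℕ → Carrier
  supFrom b k = ⋁ (λ x → Σ[ n ∈ ℕ ] (k ≤ℕ n × x ≡ b n))

  infFrom : (ℕ → Carrier) → ℕ → Carrier
  infFrom b k = ⋀ (λ x → Σ[ n ∈ ℕ ] (k ≤ℕ n × x ≡ b n))

  limsup : (ℕ → Carrier) → Carrier
  limsup b = ⋀ (λ x → Σ[ k ∈ ℕ ] x ≡ supFrom b k)

  liminf : (ℕ → Carrier) → Carrier
  liminf b = ⋁ (λ x → Σ[ k ∈ ℕ ] x ≡ infFrom b k)

  AlgConv : (ℕ → Carrier) → Carrier → Set ℓ
  AlgConv b c = limsup b ≡ c × liminf b ≡ c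

  record Topology : Set (suc ℓ) where
    field
      IsOpen     : Subset → Set ℓ
      open-ext   : ∀ {U V} → U ⊆ V → V ⊆ U → IsOpen U → IsOpen V
      open-full  : IsOpen (λ _ → Lift ℓ ⊤)
      open-empty : IsOpen (λ _ → Lift ℓ ⊥)
      open-⋃     : ∀ {I : Set ℓ} (F : I → Subset) → (∀ i → IsOpen (F i))
                   → IsOpen (λ x → Σ[ i ∈ I ] F i x)
      open-∩     : ∀ {U V} → IsOpen U → IsOpen V → IsOpen (λ x → U x × V x)

  ConvergesIn : Topology → (ℕ → Carrier) → Carrier → Set (suc ℓ)
  ConvergesIn T b x = ∀ U → Topology.IsOpen T U → U x
                      → Σ[ k ∈ ℕ ] (∀ n → k ≤ℕ n → U (b n))

  Admissible : Topology → Set (suc ℓ)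
  Admissible T = ∀ b c → AlgConv b c → ConvergesIn T b c

  -- τ_s: the largest such topology; its open sets are exactly those open
  -- in some admissible topology
  τs-Open : Subset → Set (suc ℓ)
  τs-Open U = Σ[ T ∈ Topology ] (Admissible T × Topology.IsOpen T U)

  τs-Nbhd : Subset → Carrier → Set (suc ℓ)
  τs-Nbhd U x = Σ[ V ∈ Subset ] (τs-Open V × V x × V ⊆ U)

  InClosure : Subset → Carrier → Set (suc ℓ)
  InClosure U x = ∀ V → τs-Open V → V x → Σ[ y ∈ Carrier ] (V y × U y)

  τs-Hausdorff : Set (suc ℓ)
  τs-Hausdorff = ∀ x y → x ≢ y
    → Σ[ U ∈ Subset ] Σ[ V ∈ Subset ]
        (τs-Open U × τs-Open V × U x × V y × (∀ z → U z → V z → ⊥))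

  IsAntichain : Subset → Set ℓ
  IsAntichain A = (∀ x → A x → x ≢ 𝟎)
                × (∀ x y → A x → A y → x ≢ y → x ∧ y ≡ 𝟎)

  IsMaximalAntichain : Subset → Set (suc ℓ)
  IsMaximalAntichain A = IsAntichain A
    × (∀ (A′ : Subset) → IsAntichain A′ → A ⊆ A′ → A′ ⊆ A)

  IsCountable : Subset → Set ℓ
  IsCountable A = Σ[ f ∈ (ℕ → Carrier) ] (∀ x → A x → Σ[ n ∈ ℕ ] f n ≡ x)

  IsFinite : Subset → Set ℓ
  IsFinite A = Σ[ xs ∈ List Carrier ] (∀ x → A x → x ∈ xs)

  IsDense : Subset → Set ℓ
  IsDense Q = ∀ b → b ≢ 𝟎 → Σ[ q ∈ Carrier ] (Q q × q ≢ 𝟎 × q ≤ b)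

  WeaklyDistributive : Set (suc ℓ)
  WeaklyDistributive =
    ∀ (P : ℕ → Subset)
    → (∀ n → IsCountable (P n) × IsMaximalAntichain (P n))
    → Σ[ Q ∈ Subset ] (IsDense Q
        × (∀ q → Q q → ∀ n → IsFinite (λ p → P n p × q ∧ p ≢ 𝟎)))

-- Enumerate each maximal antichain Pₙ and let Aₙ(k) be the join of its first k members;
-- for each n these increase to 𝟏. Put a = ⋀_g ⋁_n Aₙ(g n)ᶜ. If a were 𝟎, the nonzero
-- elements lying below some Aₙ(f n) for every n would form a dense set, each meeting only
-- the first f n members of Pₙ, so B would be weakly distributive. For c ≤ a and a τ_s-open
-- W ∋ 𝟎, choose zₙ₊₁ = zₙ ∨ (c ∧ Aₙ(Kₙ)ᶜ) in W: for fixed n these joins decrease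
-- algebraically to zₙ as K grows, so some Kₙ works. Since c ≤ ⋁_n Aₙ(Kₙ)ᶜ, the zₙ increase
-- to c, so every τ_s-open set containing c also contains some zₙ ∈ W.
module Submission where

open import Level using (Level)
open import Data.Product using (Σ; Σ-syntax; _×_; _,_; proj₁; proj₂)
open import Data.Sum using (_⊎_; inj₁; inj₂)
open import Data.Empty using (⊥-elim)
open import Data.Nat using (ℕ; zero; suc; _<_; _⊔_; _≤′_; ≤′-refl; ≤′-step) renaming (_≤_ to _≤ℕ_)
open import Data.Nat.Properties using (≤⇒≤′; m≤m⊔n; m≤n⊔m; m≤n⇒m≤1+n) renaming (≤-refl to ≤ℕ-refl)
open import Data.List using (applyUpTo)
open import Data.List.Membership.Propositional using (_∈_)
open import Data.List.Membership.Propositional.Properties using (∈-applyUpTo⁺)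
open import Relation.Binary.PropositionalEquality using (_≡_; _≢_; refl; sym; subst)
open import Relation.Nullary using (¬_)
open import Axiom.ExcludedMiddle using (ExcludedMiddle)
open import Axiom.DoubleNegationElimination using (em⇒dne)

open import Defs

module CBAProperties {ℓ : Level} (B : CBA ℓ) where
  open CBA B

  ≤-reflexive : ∀ {x y} → x ≡ y → x ≤ y
  ≤-reflexive refl = ≤-refl

  ≤𝟎⇒≡𝟎 : ∀ {x} → x ≤ 𝟎 → x ≡ 𝟎
  ≤𝟎⇒≡𝟎 p = ≤-antisym p 𝟎-least

  ∧-comm-≤ : ∀ {x y} → x ∧ y ≤ y ∧ x
  ∧-comm-≤ = ∧-glb ∧-lb₂ ∧-lb₁

  ∧-mono : ∀ {x x′ y y′} → x ≤ x′ → y ≤ y′ → x ∧ y ≤ x′ ∧ y′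
  ∧-mono p q = ∧-glb (≤-trans ∧-lb₁ p) (≤-trans ∧-lb₂ q)

  ≤-compl⇒∧≤𝟎 : ∀ {x y} → x ≤ y ᶜ → x ∧ y ≤ 𝟎
  ≤-compl⇒∧≤𝟎 {y = y} p = ≤-trans (∧-mono p ≤-refl) (≤-trans ∧-comm-≤ (≤-reflexive (∧-compl y)))

  ≤-split : ∀ x y → x ≤ (x ∧ y) ∨ (x ∧ (y ᶜ))
  ≤-split x y = ≤-trans (∧-glb ≤-refl (≤-trans 𝟏-greatest (≤-reflexive (sym (∨-compl y)))))
                        (≤-reflexive (∧-distrib-∨ x y (y ᶜ)))

  ∧-compl≤𝟎⇒≤ : ∀ {x y} → x ∧ (y ᶜ) ≤ 𝟎 → x ≤ y
  ∧-compl≤𝟎⇒≤ {x} {y} p = ≤-trans (≤-split x y) (∨-lub ∧-lb₂ (≤-trans p 𝟎-least))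

  ∧≤𝟎⇒≤-compl : ∀ {x y} → x ∧ y ≤ 𝟎 → x ≤ y ᶜ
  ∧≤𝟎⇒≤-compl {x} {y} p = ≤-trans (≤-split x y) (∨-lub (≤-trans p 𝟎-least) ∧-lb₂)

  compl-antitone : ∀ {x y} → x ≤ y → y ᶜ ≤ x ᶜ
  compl-antitone {y = y} p = ∧≤𝟎⇒≤-compl (≤-trans (∧-mono ≤-refl p) (≤-trans ∧-comm-≤ (≤-reflexive (∧-compl y))))

  compl≡𝟎⇒𝟏≤ : ∀ {x} → x ᶜ ≡ 𝟎 → 𝟏 ≤ x
  compl≡𝟎⇒𝟏≤ {x} e = ≤-trans (≤-reflexive (sym (∨-compl x))) (∨-lub ≤-refl (≤-trans (≤-reflexive e) 𝟎-least))

  ∨-∧-compl-≤ : ∀ z w → (z ∨ w) ∧ (z ᶜ) ≤ w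
  ∨-∧-compl-≤ z w =
    ≤-trans ∧-comm-≤ (≤-trans (≤-reflexive (∧-distrib-∨ (z ᶜ) z w))
                              (∨-lub (≤-trans ∧-comm-≤ (≤-trans (≤-reflexive (∧-compl z)) 𝟎-least)) ∧-lb₂))

  ∧-⋁-≤ : ∀ (S : Subset B) {x t} → (∀ y → S y → x ∧ y ≤ t) → x ∧ ⋁ S ≤ t
  ∧-⋁-≤ S {x} {t} h =
    ≤-trans (∧-mono ≤-refl ⋁S≤t∨xᶜ)
            (≤-trans (≤-reflexive (∧-distrib-∨ x t (x ᶜ)))
                     (∨-lub ∧-lb₂ (≤-trans (≤-reflexive (∧-compl x)) 𝟎-least)))
    where
      ⋁S≤t∨xᶜ : ⋁ S ≤ t ∨ (x ᶜ)
      ⋁S≤t∨xᶜ = ⋁-least S λ y Sy →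
        ≤-trans (≤-split y x) (∨-lub (≤-trans ∧-comm-≤ (≤-trans (h y Sy) ∨-ub₁)) (≤-trans ∧-lb₂ ∨-ub₂))

  ⋀-lb : ∀ (S : Subset B) {s} → S s → ⋀ S ≤ s
  ⋀-lb S Ss = ⋁-least _ λ _ lb → lb _ Ss

  ⋀-glb : ∀ (S : Subset B) {x} → (∀ s → S s → x ≤ s) → x ≤ ⋀ S
  ⋀-glb S = ⋁-ub _

  range : (ℕ → Carrier) → Subset B
  range f x = Σ[ n ∈ ℕ ] x ≡ f n

  ⋁-range-mono : ∀ {f g} → (∀ k → f k ≤ g k) → ⋁ (range f) ≤ ⋁ (range g)
  ⋁-range-mono p = ⋁-least _ λ { _ (k , refl) → ≤-trans (p k) (⋁-ub _ (k , refl)) }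

  ⋀-range-mono : ∀ {f g} → (∀ k → f k ≤ g k) → ⋀ (range f) ≤ ⋀ (range g)
  ⋀-range-mono p = ⋀-glb _ λ { _ (k , refl) → ≤-trans (⋀-lb _ (k , refl)) (p k) }

  ⋁-range-cong : ∀ {f g} → (∀ k → f k ≡ g k) → ⋁ (range f) ≡ ⋁ (range g)
  ⋁-range-cong e = ≤-antisym (⋁-range-mono λ k → ≤-reflexive (e k))
                             (⋁-range-mono λ k → ≤-reflexive (sym (e k)))

  ⋀-range-cong : ∀ {f g} → (∀ k → f k ≡ g k) → ⋀ (range f) ≡ ⋀ (range g)
  ⋀-range-cong e = ≤-antisym (⋀-range-mono λ k → ≤-reflexive (e k))
                             (⋀-range-mono λ k → ≤-reflexive (sym (e k)))

  ⋁-range-const : ∀ {f s} → (∀ k → f k ≡ s) → ⋁ (range f) ≡ s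
  ⋁-range-const e = ≤-antisym (⋁-least _ λ { _ (k , refl) → ≤-reflexive (e k) })
                              (≤-trans (≤-reflexive (sym (e 0))) (⋁-ub _ (0 , refl)))

  ⋀-range-const : ∀ {f s} → (∀ k → f k ≡ s) → ⋀ (range f) ≡ s
  ⋀-range-const e = ≤-antisym (≤-trans (⋀-lb _ (0 , refl)) (≤-reflexive (e 0)))
                              (⋀-glb _ λ { _ (k , refl) → ≤-reflexive (sym (e k)) })

  Increasing : (ℕ → Carrier) → Set ℓ
  Increasing z = ∀ n → z n ≤ z (suc n)

  Decreasing : (ℕ → Carrier) → Set ℓ
  Decreasing z = ∀ n → z (suc n) ≤ z n

  increasing-mono : ∀ {z} → Increasing z → ∀ {i j} → i ≤ℕ j → z i ≤ z j
  increasing-mono {z} inc i≤j = go (≤⇒≤′ i≤j)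
    where
      go : ∀ {i j} → i ≤′ j → z i ≤ z j
      go ≤′-refl = ≤-refl
      go (≤′-step p) = ≤-trans (go p) (inc _)

  decreasing-antitone : ∀ {z} → Decreasing z → ∀ {i j} → i ≤ℕ j → z j ≤ z i
  decreasing-antitone {z} dec i≤j = go (≤⇒≤′ i≤j)
    where
      go : ∀ {i j} → i ≤′ j → z j ≤ z i
      go ≤′-refl = ≤-refl
      go (≤′-step p) = ≤-trans (dec _) (go p)

  supFrom-increasing : ∀ {z} → Increasing z → ∀ k → supFrom B z k ≡ ⋁ (range z)
  supFrom-increasing {z} inc k = ≤-antisym
    (⋁-least _ λ { _ (n , _ , refl) → ⋁-ub _ (n , refl) })
    (⋁-least _ λ { _ (n , refl) → ≤-trans (increasing-mono inc (m≤m⊔n n k))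
                                           (⋁-ub _ (n ⊔ k , m≤n⊔m n k , refl)) })

  infFrom-increasing : ∀ {z} → Increasing z → ∀ k → infFrom B z k ≡ z k
  infFrom-increasing inc k = ≤-antisym
    (⋀-lb _ (k , ≤ℕ-refl , refl))
    (⋀-glb _ λ { _ (n , k≤n , refl) → increasing-mono inc k≤n })

  supFrom-decreasing : ∀ {z} → Decreasing z → ∀ k → supFrom B z k ≡ z k
  supFrom-decreasing dec k = ≤-antisym
    (⋁-least _ λ { _ (n , k≤n , refl) → decreasing-antitone dec k≤n })
    (⋁-ub _ (k , ≤ℕ-refl , refl))

  infFrom-decreasing : ∀ {z} → Decreasing z → ∀ k → infFrom B z k ≡ ⋀ (range z)
  infFrom-decreasing {z} dec k = ≤-antisym
    (⋀-glb _ λ { _ (n , refl) → ≤-trans (⋀-lb _ (n ⊔ k , m≤n⊔m n k , refl))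
                                         (decreasing-antitone dec (m≤m⊔n n k)) })
    (⋀-glb _ λ { _ (n , _ , refl) → ⋀-lb _ (n , refl) })

  increasing-algConv : ∀ {z} → Increasing z → AlgConv B z (⋁ (range z))
  increasing-algConv inc = ⋀-range-const (supFrom-increasing inc) , ⋁-range-cong (infFrom-increasing inc)

  decreasing-algConv : ∀ {z} → Decreasing z → AlgConv B z (⋀ (range z))
  decreasing-algConv dec = ⋀-range-cong (supFrom-decreasing dec) , ⋁-range-const (infFrom-decreasing dec)

module SequentialTopology {ℓ : Level} (B : CBA ℓ) where
  open CBA B

  τs-Open⇒eventually : ∀ {V b c} → τs-Open B V → AlgConv B b c → V c
                       → Σ[ k ∈ ℕ ] (∀ n → k ≤ℕ n → V (b n))
  τs-Open⇒eventually {b = b} {c} (_ , admissible , V-open) conv Vc = admissible b c conv _ V-open Vc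

  InClosure-mono : ∀ {U U′ x} → _⊆_ B U U′ → InClosure B U x → InClosure B U′ x
  InClosure-mono U⊆U′ x∈clU V V-open Vx =
    let y , Vy , Uy = x∈clU V V-open Vx in y , Vy , U⊆U′ y Uy

  inClosure⇒¬τs-Hausdorff : ∀ {x y} → x ≢ y → (∀ U → τs-Nbhd B U y → InClosure B U x)
                            → ¬ τs-Hausdorff B
  inClosure⇒¬τs-Hausdorff {x} {y} x≢y x∈cl haus =
    let U , V , U-open , V-open , Ux , Vy , disjoint = haus x y x≢y
        z , Uz , Vz = x∈cl V (V , V-open , Vy , λ _ Vw → Vw) U U-open Ux
    in disjoint z Uz Vz

module Classical (em : ∀ {ℓ′} → ExcludedMiddle ℓ′) {ℓ : Level} (B : CBA ℓ) where
  open CBA B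
  open CBAProperties B
  open SequentialTopology B

  dne : ∀ {ℓ′} {X : Set ℓ′} → ¬ ¬ X → X
  dne = em⇒dne em

  -- Otherwise (⋁ S)ᶜ could be added to S.
  maximalAntichain-⋁≥𝟏 : ∀ {S} → IsMaximalAntichain B S → 𝟏 ≤ ⋁ S
  maximalAntichain-⋁≥𝟏 {S} ((nonzero , disjoint) , maximal) = compl≡𝟎⇒𝟏≤ (dne λ r≢𝟎 → r≢𝟎 (r≡𝟎 (r∈S r≢𝟎)))
    where
      r = (⋁ S) ᶜ

      ∧r≤𝟎 : ∀ {x} → S x → x ∧ r ≤ 𝟎
      ∧r≤𝟎 Sx = ≤-trans (∧-mono (⋁-ub S Sx) ≤-refl) (≤-reflexive (∧-compl (⋁ S)))

      r≡𝟎 : S r → r ≡ 𝟎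
      r≡𝟎 Sr = ≤𝟎⇒≡𝟎 (≤-trans (∧-glb ≤-refl ≤-refl) (∧r≤𝟎 Sr))

      extended : r ≢ 𝟎 → IsAntichain B (λ x → S x ⊎ x ≡ r)
      extended r≢𝟎 =
          (λ { x (inj₁ Sx) → nonzero x Sx ; _ (inj₂ refl) → r≢𝟎 })
        , (λ { x y (inj₁ Sx) (inj₁ Sy) x≢y → disjoint x y Sx Sy x≢y
             ; _ _ (inj₁ Sx) (inj₂ refl) _ → ≤𝟎⇒≡𝟎 (∧r≤𝟎 Sx)
             ; _ _ (inj₂ refl) (inj₁ Sy) _ → ≤𝟎⇒≡𝟎 (≤-trans ∧-comm-≤ (∧r≤𝟎 Sy))
             ; _ _ (inj₂ refl) (inj₂ refl) r≢r → ⊥-elim (r≢r refl) })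

      r∈S : r ≢ 𝟎 → S r
      r∈S r≢𝟎 = maximal _ (extended r≢𝟎) (λ _ → inj₁) r (inj₂ refl)

  MeetsFinitely : (ℕ → Subset B) → Subset B → Set ℓ
  MeetsFinitely P Q = ∀ q → Q q → ∀ n → IsFinite B (λ p → P n p × q ∧ p ≢ 𝟎)

  ¬weaklyDistributive⇒counterexample : ¬ WeaklyDistributive B
    → Σ[ P ∈ (ℕ → Subset B) ] ((∀ n → IsCountable B (P n) × IsMaximalAntichain B (P n))
                              × ¬ (Σ[ Q ∈ Subset B ] (IsDense B Q × MeetsFinitely P Q)))
  ¬weaklyDistributive⇒counterexample ¬wd =
    dne λ none → ¬wd λ P P-ok → dne λ ¬Q → none (P , P-ok , ¬Q)

  module Exhaustion (A : ℕ → ℕ → Carrier) (A-increasing : ∀ n → Increasing (A n))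
                    (A-exhausts : ∀ n → 𝟏 ≤ ⋁ (range (A n))) where

    escape : (ℕ → ℕ) → Carrier
    escape g = ⋁ (range λ n → A n (g n) ᶜ)

    a : Carrier
    a = ⋀ (λ x → Σ[ g ∈ (ℕ → ℕ) ] x ≡ escape g)

    Bounded : Subset B
    Bounded q = q ≢ 𝟎 × Σ[ f ∈ (ℕ → ℕ) ] (∀ n → q ≤ A n (f n))

    a≡𝟎⇒Bounded-dense : a ≡ 𝟎 → IsDense B Bounded
    a≡𝟎⇒Bounded-dense a≡𝟎 b b≢𝟎 = b ∧ (escape g ᶜ) , (b′≢𝟎 , g , b′≤A) , b′≢𝟎 , ∧-lb₁
      where
        escaping : Σ[ g ∈ (ℕ → ℕ) ] ¬ (b ≤ escape g)
        escaping = dne λ none → b≢𝟎 (≤𝟎⇒≡𝟎 (≤-trans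
          (⋀-glb _ λ { _ (g , refl) → dne λ b≰ → none (g , b≰) }) (≤-reflexive a≡𝟎)))

        g = proj₁ escaping

        b′≢𝟎 : b ∧ (escape g ᶜ) ≢ 𝟎
        b′≢𝟎 e = proj₂ escaping (∧-compl≤𝟎⇒≤ (≤-reflexive e))

        b′≤A : ∀ n → b ∧ (escape g ᶜ) ≤ A n (g n)
        b′≤A n = ∧-compl≤𝟎⇒≤ (≤-compl⇒∧≤𝟎 (≤-trans ∧-lb₂ (compl-antitone (⋁-ub _ (n , refl)))))

    shrink : ℕ → Carrier → Carrier → ℕ → Carrier
    shrink n c z k = z ∨ (c ∧ (A n k ᶜ))

    shrink-algConv : ∀ n c z → AlgConv B (shrink n c z) z
    shrink-algConv n c z = subst (AlgConv B (shrink n c z)) inf≡z (decreasing-algConv decreasing)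
      where
        decreasing : Decreasing (shrink n c z)
        decreasing k = ∨-lub ∨-ub₁ (≤-trans (∧-mono ≤-refl (compl-antitone (A-increasing n k))) ∨-ub₂)

        inf = ⋀ (range (shrink n c z))

        excess≤A-compl : ∀ k → inf ∧ (z ᶜ) ≤ A n k ᶜ
        excess≤A-compl k = ≤-trans (∧-mono (⋀-lb _ (k , refl)) ≤-refl) (≤-trans (∨-∧-compl-≤ z _) ∧-lb₂)

        excess≤𝟎 : inf ∧ (z ᶜ) ≤ 𝟎
        excess≤𝟎 = ≤-trans (∧-glb ≤-refl (≤-trans 𝟏-greatest (A-exhausts n)))
                           (∧-⋁-≤ _ λ { _ (k , refl) → ≤-compl⇒∧≤𝟎 (excess≤A-compl k) })

        inf≡z : inf ≡ z
        inf≡z = ≤-antisym (∧-compl≤𝟎⇒≤ excess≤𝟎) (⋀-glb _ λ { _ (k , refl) → ∨-ub₁ })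

    module Approximation (c : Carrier) (c≤a : c ≤ a)
                         (W : Subset B) (W-open : τs-Open B W) (W𝟎 : W 𝟎) where

      nextIndex : ∀ n z → W z → Σ[ K ∈ ℕ ] W (shrink n c z K)
      nextIndex n z Wz = let k , eventually = τs-Open⇒eventually W-open (shrink-algConv n c z) Wz
                         in k , eventually k ≤ℕ-refl

      next : ℕ → Σ Carrier W → Σ Carrier W
      next n (z , Wz) = shrink n c z (proj₁ (nextIndex n z Wz)) , proj₂ (nextIndex n z Wz)

      approx : ℕ → Σ Carrier W
      approx zero = 𝟎 , W𝟎
      approx (suc n) = next n (approx n)

      z : ℕ → Carrier
      z n = proj₁ (approx n)

      K : ℕ → ℕ
      K n = proj₁ (nextIndex n (z n) (proj₂ (approx n)))

      z-increasing : Increasing z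
      z-increasing _ = ∨-ub₁

      z≤c : ∀ n → z n ≤ c
      z≤c zero = 𝟎-least
      z≤c (suc n) = ∨-lub (z≤c n) ∧-lb₁

      -- c ≤ a ≤ escape K, and each c ∧ Aₙ(Kₙ)ᶜ was added at step n + 1.
      ⋁z≡c : ⋁ (range z) ≡ c
      ⋁z≡c = ≤-antisym (⋁-least _ λ { _ (n , refl) → z≤c n })
        (≤-trans (∧-glb ≤-refl (≤-trans c≤a (⋀-lb _ (K , refl))))
                 (∧-⋁-≤ _ λ { _ (n , refl) → ≤-trans ∨-ub₂ (⋁-ub _ (suc n , refl)) }))

      z-algConv : AlgConv B z c
      z-algConv = subst (AlgConv B z) ⋁z≡c (increasing-algConv z-increasing)

      c∈clW : InClosure B W c
      c∈clW V V-open Vc =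
        let k , eventually = τs-Open⇒eventually V-open z-algConv Vc
        in z k , eventually k ≤ℕ-refl , proj₂ (approx k)

    ≤a⇒inClosure : ∀ c → c ≤ a → ∀ U → τs-Nbhd B U 𝟎 → InClosure B U c
    ≤a⇒inClosure c c≤a U (W , W-open , W𝟎 , W⊆U) =
      InClosure-mono W⊆U (Approximation.c∈clW c c≤a W W-open W𝟎)

  module Enumerated (P : ℕ → Subset B)
                    (P-ok : ∀ n → IsCountable B (P n) × IsMaximalAntichain B (P n)) where

    enum : ℕ → ℕ → Carrier
    enum n = proj₁ (proj₁ (P-ok n))

    initial : ℕ → ℕ → Subset B
    initial n k x = P n x × Σ[ j ∈ ℕ ] (j < k × enum n j ≡ x)

    A : ℕ → ℕ → Carrier
    A n k = ⋁ (initial n k)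

    A-increasing : ∀ n → Increasing (A n)
    A-increasing n k = ⋁-least _ λ { _ (Px , j , j<k , e) → ⋁-ub _ (Px , j , m≤n⇒m≤1+n j<k , e) }

    A-exhausts : ∀ n → 𝟏 ≤ ⋁ (range (A n))
    A-exhausts n = ≤-trans (maximalAntichain-⋁≥𝟏 (proj₂ (P-ok n))) (⋁-least _ λ x Px →
      let j , e = proj₂ (proj₁ (P-ok n)) x Px
      in ≤-trans (⋁-ub (initial n (suc j)) (Px , j , ≤ℕ-refl , e)) (⋁-ub _ (suc j , refl)))

    open Exhaustion A A-increasing A-exhausts public

    ∉-enumerated⇒∧A≤𝟎 : ∀ {p} n k → P n p → ¬ (p ∈ applyUpTo (enum n) k) → p ∧ A n k ≤ 𝟎
    ∉-enumerated⇒∧A≤𝟎 {p} n k Pp p∉ = ∧-⋁-≤ _ λ { x (Px , j , j<k , e) →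
      ≤-reflexive (proj₂ (proj₁ (proj₂ (P-ok n))) p x Pp Px λ { refl →
        p∉ (subst (_∈ applyUpTo (enum n) k) e (∈-applyUpTo⁺ (enum n) j<k)) }) }

    Bounded-meetsFinitely : MeetsFinitely P Bounded
    Bounded-meetsFinitely q (_ , f , q≤A) n = applyUpTo (enum n) (f n) , λ p (Pp , q∧p≢𝟎) →
      dne λ p∉ → q∧p≢𝟎 (≤𝟎⇒≡𝟎 (≤-trans (∧-mono (q≤A n) ≤-refl)
                                         (≤-trans ∧-comm-≤ (∉-enumerated⇒∧A≤𝟎 n (f n) Pp p∉))))

lemma4p2 : (em : ∀ {ℓ′} → ExcludedMiddle ℓ′) → ∀ {ℓ : Level} (B : CBA ℓ)
  → ¬ WeaklyDistributive B
  → Σ[ a ∈ CBA.Carrier B ] (a ≢ CBA.𝟎 B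
      × (∀ c → CBA._≤_ B c a → ∀ U → τs-Nbhd B U (CBA.𝟎 B) → InClosure B U c))
    × ¬ τs-Hausdorff B
lemma4p2 em B ¬wd =
  a , (a≢𝟎 , ≤a⇒inClosure) , inClosure⇒¬τs-Hausdorff a≢𝟎 (≤a⇒inClosure a ≤-refl)
  where
    open CBA B using (𝟎; ≤-refl)
    open SequentialTopology B
    open Classical em B
    counterexample = ¬weaklyDistributive⇒counterexample ¬wd
    open Enumerated (proj₁ counterexample) (proj₁ (proj₂ counterexample))

    a≢𝟎 : a ≢ 𝟎
    a≢𝟎 a≡𝟎 = proj₂ (proj₂ counterexample) (Bounded , a≡𝟎⇒Bounded-dense a≡𝟎 , Bounded-meetsFinitely)
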